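{- Let $P$ be a set of primes and let $T$ be a map (each of whose iterates has finitely many fixed points) with $\mathcal O_T=s_P$. Let $k\ge1$ have prime decomposition $k=\prod_{p\in P}p^{a_p}\cdot\prod_{p\in Q}p^{a_p}$, where $Q$ is a set of primes with $P\cap Q=\emptyset$. Then for every $n\ge1$, \[ \mathcal O_{T^k}(n)=\begin{cases}\displaystyle\prod_{p\in Q,\ p\mid n}p^{a_p}\cdot\prod_{p\in Q,\ p\nmid n}\sigma(p^{a_p}) & \text{if } p\nmid n \text{ for all } p\in P,\\[2mm] 0 & \text{if } p\mid n \text{ for some } p\in P,\end{cases} \] where $\sigma$ is the sum-of-divisors function.
   Context: For a map $R$, $\mathcal O_R(n)$ is the number of closed orbits of $R$ of length $n$, i.e. sets $\{x,Rx,\dots,R^{n-1}x\}$ with $R^nx=x$ of cardinality exactly $n$; $T^k$ denotes the $k$-th iterate of $T$. For a set $P$ of primes, $s_P:\mathbb N\to\{0,1\}$ is the sequence with $s_P(n)=0$ if $p\mid n$ for some $p\in P$, and $s_P(n)=1$ otherwise. -}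

module Defs where

open import Data.Nat using (ℕ; zero; suc; _+_; _*_; _^_; _<_; _≤_)
open import Data.Nat.Divisibility using (_∣_; _∣?_)
open import Data.Nat.Primality using (Prime)
open import Data.List using (List; []; _∷_; map; filter; applyUpTo)
open import Data.Nat.ListAction using (sum; product)
open import Data.List.Relation.Unary.All using (All)
open import Data.List.Relation.Unary.Unique.Propositional using (Unique)
open import Data.Fin using (Fin)
open import Data.Product using (Σ; ∃; _×_; _,_; proj₁; proj₂)
open import Relation.Binary.PropositionalEquality using (_≡_)
open import Relation.Nullary using (¬_)
open import Relation.Nullary.Decidable using (does)
open import Data.Bool using (if_then_else_)

iter : {X : Set} → (X → X) → ℕ → X → X
iter R zero    x = x
iter R (suc n) x = R (iter R n x)

-- x generates a closed orbit {x, Rx, ..., R^(n-1) x} of length n: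
-- R^n x = x and the n points R^i x (i < n) are pairwise distinct
-- (i.e. the orbit set has cardinality exactly n).
ClosedOrbitOfLength : {X : Set} → (X → X) → ℕ → X → Set
ClosedOrbitOfLength R n x =
  (iter R n x ≡ x) × (∀ i j → i < n → j < n → iter R i x ≡ iter R j x → i ≡ j)

-- y lies in the orbit {x, Rx, R^2 x, ...} of x (for closed orbits: the same orbit set)
InOrbit : {X : Set} → (X → X) → X → X → Set
InOrbit R x y = ∃ λ i → iter R i x ≡ y

-- O_R(n) = m : there are exactly m closed orbits of length n, i.e. there are
-- m representatives generating closed orbits of length n, the orbits of distinct
-- representatives are distinct, and every closed orbit of length n is one of them.
OrbitCount : {X : Set} → (X → X) → ℕ → ℕ → Set
OrbitCount {X} R n m =
  Σ (Fin m → X) λ xs →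
    (∀ a → ClosedOrbitOfLength R n (xs a)) ×
    (∀ a b → InOrbit R (xs a) (xs b) → a ≡ b) ×
    (∀ y → ClosedOrbitOfLength R n y → ∃ λ a → InOrbit R (xs a) y)

FinitelyManyFixedPoints : {X : Set} → (X → X) → Set
FinitelyManyFixedPoints {X} R =
  ∀ n → 1 ≤ n → Σ (List X) λ l → ∀ x → iter R n x ≡ x → Data.List.Membership.Propositional._∈_ x l
  where import Data.List.Membership.Propositional

σ : ℕ → ℕ
σ m = sum (filter (λ d → d ∣? m) (applyUpTo suc m))

-- the factor ∏_{p∈Q, p∣n} p^{a_p} · ∏_{p∈Q, p∤n} σ(p^{a_p}), with Q given as a
-- list of (p , a_p) pairs
orbitFactor : List (ℕ × ℕ) → ℕ → ℕ
orbitFactor qs n =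
  product (map (λ { (p , a) → if does (p ∣? n) then p ^ a else σ (p ^ a) }) qs)

module Submission where

-- The proof rests on a general formula for the closed orbits of an iterate S^r.
-- A point on a closed S^r-orbit of length n has a minimal S-period m (it exists
-- because fixed points of iterates are finitely many, so equality among them is
-- decidable), and m = n·g where g = gcd(m, r) is admissible: r = e·g with n
-- coprime to e. Conversely, for admissible d every closed S-orbit of length n·d
-- splits into exactly d closed S^r-orbits of length n, represented by x, S x, ...,
-- S^(d-1) x; the offsets are distinguished modulo d, and S^d x is reached from x
-- by S^r-steps via Bézout for gcd(n·d, r) = d. Summing over admissible d gives
-- O_{S^r}(n) = Σ_d d·O_S(n·d). For r = q^a a prime power, only d = q^a is
-- admissible when q ∣ n and every divisor of q^a is when q ∤ n, producing the
-- factors q^a and σ(q^a). The theorem follows by induction on the prime powers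
-- of k outside P, starting from the P-part kP of k, for which only d = 1 carries
-- orbits when n is free of P-primes and no d does otherwise.

open import Defs
open import Data.Nat
  using (ℕ; zero; suc; _+_; _*_; _∸_; _^_; _≤_; _<_; _%_; _/_; s≤s; z≤n; NonZero; >-nonZero; >-nonZero⁻¹; ≢-nonZero; ≢-nonZero⁻¹)
open import Data.Nat.Properties
open import Data.Nat.DivMod using (m/n*n≡m; m≡m%n+[m/n]*n; m%n<n; m<n⇒m%n≡m; m∣n⇒o%n%m≡o%m; %-remove-+ˡ)
open import Data.Nat.Divisibility
open import Data.Nat.GCD using (gcd; gcd[m,n]∣m; gcd[m,n]∣n; c*gcd[m,n]≡gcd[cm,cn]; module Bézout; gcd-GCD)
open import Data.Nat.Coprimality as Coprimality using (Coprime; coprime⇒gcd≡1; coprime-divisor; coprime-/gcd; 1-coprimeTo)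
open import Data.Nat.Tactic.RingSolver using (solve-∀)
open import Data.Nat.Primality using (Prime; prime[2]; ¬prime[1]; prime⇒nonZero; prime⇒irreducible; euclidsLemma)
open import Data.Nat.Primality.Factorisation using (factorise)
open import Data.Nat.ListAction using (sum; product)
open import Data.Nat.Induction using (<-wellFounded)
open import Induction.WellFounded using (Acc; acc)
open import Data.Fin using (Fin; toℕ; fromℕ<; remQuot; combine; splitAt; _↑ˡ_; _↑ʳ_)
import Data.Fin.Properties as Finₚ
open import Data.List using (List; []; _∷_; map; filter; applyUpTo; length; lookup)
open import Data.List.Relation.Unary.All as All using (All; []; _∷_)
import Data.List.Relation.Unary.All.Properties as Allₚ
open import Data.List.Relation.Unary.Any as Any using (Any; here; toSum; fromSum)
open import Data.List.Relation.Unary.Any.Properties using (lookup-index)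
open import Data.List.Relation.Unary.Unique.Propositional using (Unique)
import Data.List.Relation.Unary.Unique.Propositional.Properties as Uniqueₚ
open import Data.List.Relation.Unary.AllPairs using ([]; _∷_)
open import Data.List.Membership.Propositional using (_∈_; find; lose)
import Data.List.Membership.Propositional.Properties as ∈ₚ
open import Data.Product using (Σ; ∃; _×_; _,_; proj₁; proj₂)
open import Data.Sum using (_⊎_; inj₁; inj₂; [_,_]′)
open import Data.Empty using (⊥; ⊥-elim)
open import Data.Bool using (if_then_else_)
open import Relation.Nullary using (¬_; Dec; yes; no; _×-dec_)
open import Relation.Nullary.Decidable using (does; dec-true; dec-false; map′)
open import Relation.Binary.PropositionalEquality
open import Axiom.UniquenessOfIdentityProofs.WithK using (uip)
open import Function using (_∘_; it)
open ≡-Reasoning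

module _ {X : Set} (R : X → X) where

  iter-+ : ∀ u v x → iter R (u + v) x ≡ iter R u (iter R v x)
  iter-+ zero    v x = refl
  iter-+ (suc u) v x = cong R (iter-+ u v x)

  iter-comm : ∀ u v x → iter R u (iter R v x) ≡ iter R v (iter R u x)
  iter-comm u v x = begin
    iter R u (iter R v x) ≡⟨ sym (iter-+ u v x) ⟩
    iter R (u + v) x      ≡⟨ cong (λ w → iter R w x) (+-comm u v) ⟩
    iter R (v + u) x      ≡⟨ iter-+ v u x ⟩
    iter R v (iter R u x) ∎

  iter-* : ∀ r n x → iter (iter R r) n x ≡ iter R (r * n) x
  iter-* r zero    x = cong (λ w → iter R w x) (sym (*-zeroʳ r))
  iter-* r (suc n) x = begin
    iter R r (iter (iter R r) n x) ≡⟨ cong (iter R r) (iter-* r n x) ⟩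
    iter R r (iter R (r * n) x)    ≡⟨ sym (iter-+ r (r * n) x) ⟩
    iter R (r + r * n) x           ≡⟨ cong (λ w → iter R w x) (sym (*-suc r n)) ⟩
    iter R (r * suc n) x           ∎

  inOrbit-trans : ∀ {x y z} → InOrbit R x y → InOrbit R y z → InOrbit R x z
  inOrbit-trans (s , refl) (t , refl) = t + s , iter-+ t s _

  module _ {m : ℕ} {x : X} (fix : iter R m x ≡ x) where

    periodic-* : ∀ q → iter R (q * m) x ≡ x
    periodic-* zero    = refl
    periodic-* (suc q) = trans (iter-+ m (q * m) x) (trans (cong (iter R m) (periodic-* q)) fix)

    periodic-∣ : ∀ {t} → m ∣ t → iter R t x ≡ x
    periodic-∣ (divides q refl) = periodic-* q

    periodic-% : .{{_ : NonZero m}} → ∀ a → iter R a x ≡ iter R (a % m) x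
    periodic-% a = begin
      iter R a x                             ≡⟨ cong (λ w → iter R w x) (m≡m%n+[m/n]*n a m) ⟩
      iter R (a % m + (a / m) * m) x         ≡⟨ iter-+ (a % m) _ x ⟩
      iter R (a % m) (iter R ((a / m) * m) x) ≡⟨ cong (iter R (a % m)) (periodic-* (a / m)) ⟩
      iter R (a % m) x                       ∎

    periodic-shift : ∀ j → iter R m (iter R j x) ≡ iter R j x
    periodic-shift j = trans (iter-comm m j x) (cong (iter R j) fix)

    periodic-return : .{{_ : NonZero m}} → ∀ j → iter R (m * j ∸ j) (iter R j x) ≡ x
    periodic-return j = begin
      iter R (m * j ∸ j) (iter R j x) ≡⟨ sym (iter-+ (m * j ∸ j) j x) ⟩
      iter R (m * j ∸ j + j) x        ≡⟨ cong (λ w → iter R w x) (m∸n+n≡m (m≤n*m j m)) ⟩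
      iter R (m * j) x                ≡⟨ cong (λ w → iter R w x) (*-comm m j) ⟩
      iter R (j * m) x                ≡⟨ periodic-* j ⟩
      x                               ∎

    periodic-cancel : .{{_ : NonZero m}} → ∀ j a b →
      iter R a (iter R j x) ≡ iter R b (iter R j x) → iter R a x ≡ iter R b x
    periodic-cancel j a b eq = begin
      iter R a x                          ≡⟨ cong (iter R a) (sym (periodic-return j)) ⟩
      iter R a (iter R e (iter R j x))    ≡⟨ iter-comm a e _ ⟩
      iter R e (iter R a (iter R j x))    ≡⟨ cong (iter R e) eq ⟩
      iter R e (iter R b (iter R j x))    ≡⟨ iter-comm e b _ ⟩
      iter R b (iter R e (iter R j x))    ≡⟨ cong (iter R b) (periodic-return j) ⟩
      iter R b x                          ∎
      where
      e : ℕ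
      e = m * j ∸ j

  module _ {m : ℕ} .{{_ : NonZero m}} {x : X} (closed : ClosedOrbitOfLength R m x) where

    closed-% : ∀ a b → iter R a x ≡ iter R b x → a % m ≡ b % m
    closed-% a b eq = proj₂ closed (a % m) (b % m) (m%n<n a m) (m%n<n b m) (begin
      iter R (a % m) x ≡⟨ sym (periodic-% (proj₁ closed) a) ⟩
      iter R a x       ≡⟨ eq ⟩
      iter R b x       ≡⟨ periodic-% (proj₁ closed) b ⟩
      iter R (b % m) x ∎)

    closed-∣ : ∀ t → iter R t x ≡ x → m ∣ t
    closed-∣ t eq = m%n≡0⇒n∣m t m (trans (closed-% t 0 eq) (m<n⇒m%n≡m (>-nonZero⁻¹ m)))

  closed-intro : ∀ {m x} .{{_ : NonZero m}} → iter R m x ≡ x →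
    (∀ t → iter R t x ≡ x → m ∣ t) → ClosedOrbitOfLength R m x
  closed-intro {m} {x} fix minimal = fix , distinct
    where
    ordered : ∀ a b → b < m → a ≤ b → iter R a x ≡ iter R b x → a ≡ b
    ordered a b b<m a≤b eq = sym (trans (sym (m∸n+n≡m a≤b)) (cong (_+ a) gap≡0))
      where
      shifted : iter R 0 (iter R a x) ≡ iter R (b ∸ a) (iter R a x)
      shifted = trans eq (trans (cong (λ w → iter R w x) (sym (m∸n+n≡m a≤b))) (iter-+ (b ∸ a) a x))
      gap≡0 : b ∸ a ≡ 0
      gap≡0 = begin
        b ∸ a       ≡⟨ sym (m<n⇒m%n≡m (≤-<-trans (m∸n≤m b a) b<m)) ⟩
        (b ∸ a) % m ≡⟨ n∣m⇒m%n≡0 (b ∸ a) m (minimal (b ∸ a) (sym (periodic-cancel fix a 0 (b ∸ a) shifted))) ⟩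
        0           ∎
    distinct : ∀ a b → a < m → b < m → iter R a x ≡ iter R b x → a ≡ b
    distinct a b a<m b<m eq with ≤-total a b
    ... | inj₁ a≤b = ordered a b b<m a≤b eq
    ... | inj₂ b≤a = sym (ordered b a a<m b≤a (sym eq))

  closed-inOrbit : ∀ {m x y} → ClosedOrbitOfLength R m x → InOrbit R x y → ClosedOrbitOfLength R m y
  closed-inOrbit {zero}  _      _        = refl , λ _ _ ()
  closed-inOrbit {suc m} closed (j , refl) =
    periodic-shift {suc m} (proj₁ closed) j ,
    λ a b a<m b<m eq → proj₂ closed a b a<m b<m (periodic-cancel {suc m} (proj₁ closed) j a b eq)

  closed-unique : ∀ {a b x} .{{_ : NonZero a}} .{{_ : NonZero b}} →
    ClosedOrbitOfLength R a x → ClosedOrbitOfLength R b x → a ≡ b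
  closed-unique ca cb = ∣-antisym (closed-∣ ca _ (proj₁ cb)) (closed-∣ cb _ (proj₁ ca))

module _ {X : Set} {f g : X → X} (f≗g : ∀ x → f x ≡ g x) where

  iter-≗ : ∀ n x → iter f n x ≡ iter g n x
  iter-≗ zero    x = refl
  iter-≗ (suc n) x = trans (f≗g _) (cong g (iter-≗ n x))

  closed-≗ : ∀ {n x} → ClosedOrbitOfLength f n x → ClosedOrbitOfLength g n x
  closed-≗ {n} (fix , distinct) =
    trans (sym (iter-≗ n _)) fix ,
    λ i j i<n j<n eq → distinct i j i<n j<n (trans (iter-≗ i _) (trans eq (sym (iter-≗ j _))))

  inOrbit-≗ : ∀ {x y} → InOrbit f x y → InOrbit g x y
  inOrbit-≗ (t , eq) = t , trans (sym (iter-≗ t _)) eq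

orbitCount-≗ : ∀ {X : Set} {f g : X → X} → (∀ x → f x ≡ g x) →
  ∀ {n c} → OrbitCount f n c → OrbitCount g n c
orbitCount-≗ f≗g (xs , closed , separated , complete) =
  xs , (λ a → closed-≗ f≗g (closed a)) ,
  (λ a b o → separated a b (inOrbit-≗ (sym ∘ f≗g) o)) ,
  λ y cy → let a , o = complete y (closed-≗ (sym ∘ f≗g) cy) in a , inOrbit-≗ f≗g o

module _ {X : Set} {R : X → X} (finite : FinitelyManyFixedPoints R) where

  iterate-finite : ∀ r → .{{_ : NonZero r}} → FinitelyManyFixedPoints (iter R r)
  iterate-finite r N N≥1 = proj₁ listed , λ x fx → proj₂ listed x (trans (sym (iter-* R r N x)) fx)
    where
    listed : Σ (List X) λ l → ∀ x → iter R (r * N) x ≡ x → x ∈ l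
    listed = finite (r * N) (>-nonZero⁻¹ (r * N) {{m*n≢0 r N {{it}} {{>-nonZero N≥1}}}})

  -- Equality of fixed points of R^M is decidable: compare their positions in the
  -- finite list of fixed points (the position is chosen uniformly, using UIP).
  fixed-≟ : ∀ {M} → 1 ≤ M → ∀ {z w} → iter R M z ≡ z → iter R M w ≡ w → Dec (z ≡ w)
  fixed-≟ {M} M≥1 {z} {w} fz fw = map′ from to (slot z fz Finₚ.≟ slot w fw)
    where
    points : List X
    points = proj₁ (finite M M≥1)
    slot : ∀ x → iter R M x ≡ x → Fin (length points)
    slot x fx = Any.index (proj₂ (finite M M≥1) x fx)
    at-slot : ∀ x fx → x ≡ lookup points (slot x fx)
    at-slot x fx = lookup-index (proj₂ (finite M M≥1) x fx)
    from : slot z fz ≡ slot w fw → z ≡ w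
    from eq = trans (at-slot z fz) (trans (cong (lookup points) eq) (sym (at-slot w fw)))
    to : z ≡ w → slot z fz ≡ slot w fw
    to refl = cong (slot z) (uip fz fw)

  closed-of-periodic : ∀ {M x} → .{{_ : NonZero M}} → iter R M x ≡ x →
    ∃ λ m → NonZero m × ClosedOrbitOfLength R m x
  closed-of-periodic {M} {x} fixM = descend M (<-wellFounded M) fixM
    where
    returns? : ∀ t → Dec (1 ≤ t × iter R t x ≡ x)
    returns? t = (1 ≤? t) ×-dec fixed-≟ (>-nonZero⁻¹ M) (periodic-shift R {M} fixM t) fixM
    descend : ∀ m → Acc _<_ m → .{{_ : NonZero m}} → iter R m x ≡ x →
      ∃ λ m → NonZero m × ClosedOrbitOfLength R m x
    descend m (acc smaller) fixm with anyUpTo? returns? m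
    ... | yes (t , t<m , 1≤t , fixt) = descend t (smaller t<m) {{>-nonZero 1≤t}} fixt
    ... | no none = m , >-nonZero (>-nonZero⁻¹ m) , closed-intro R fixm minimal
      where
      minimal : ∀ t → iter R t x ≡ x → m ∣ t
      minimal t fixt with t % m in rem
      ... | zero  = m%n≡0⇒n∣m t m rem
      ... | suc s = ⊥-elim (none (suc s , subst (_< m) rem (m%n<n t m) , s≤s z≤n ,
                      subst (λ w → iter R w x ≡ x) rem (trans (sym (periodic-% R fixm t)) fixt)))

nonZero-divisor : ∀ {d n} .{{_ : NonZero n}} → d ∣ n → NonZero d
nonZero-divisor {zero} {n} 0∣n = ⊥-elim (≢-nonZero⁻¹ n (0∣⇒≡0 0∣n))
nonZero-divisor {suc d}    _   = _

prime-divisor : ∀ n → .{{_ : NonZero n}} → n ≢ 1 → ∃ λ p → Prime p × p ∣ n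
prime-divisor n n≢1 with factorise n
... | record { factors = [] ; isFactorisation = n≡1 } = ⊥-elim (n≢1 n≡1)
... | record { factors = p ∷ ps ; isFactorisation = n≡p*ps ; factorsPrime = p-prime ∷ _ } =
  p , p-prime , subst (p ∣_) (sym n≡p*ps) (m∣m*n (product ps))

prime∣prime^ : ∀ {p q} a → Prime p → Prime q → p ∣ q ^ a → p ≡ q
prime∣prime^ zero    p-prime _       p∣1 = ⊥-elim (¬prime[1] (subst Prime (∣1⇒≡1 p∣1) p-prime))
prime∣prime^ {q = q} (suc a) p-prime q-prime p∣q^1+a with euclidsLemma q (q ^ a) p-prime p∣q^1+a
... | inj₂ p∣q^a = prime∣prime^ a p-prime q-prime p∣q^a
... | inj₁ p∣q with prime⇒irreducible q-prime p∣q
...   | inj₁ p≡1 = ⊥-elim (¬prime[1] (subst Prime p≡1 p-prime))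
...   | inj₂ p≡q = p≡q

coprime-by-primes : ∀ {m n} → (∀ p → Prime p → p ∣ m → p ∣ n → ⊥) → Coprime m n
coprime-by-primes no-common {i} (i∣m , i∣n) with i ≟ 0 | i ≟ 1
... | _ | yes i≡1 = i≡1
... | yes refl | _ = ⊥-elim (no-common 2 prime[2]
                     (subst (2 ∣_) (sym (0∣⇒≡0 i∣m)) (2 ∣0)) (subst (2 ∣_) (sym (0∣⇒≡0 i∣n)) (2 ∣0)))
... | no i≢0 | no i≢1 =
  let p , p-prime , p∣i = prime-divisor i {{≢-nonZero i≢0}} i≢1
  in ⊥-elim (no-common p p-prime (∣-trans p∣i i∣m) (∣-trans p∣i i∣n))

prime^-divisor : ∀ {q e} a → Prime q → e ∣ q ^ a → ¬ q ∣ e → e ≡ 1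
prime^-divisor {q} {e} a q-prime e∣q^a q∤e with e ≟ 1
... | yes e≡1 = e≡1
... | no e≢1 =
  let p , p-prime , p∣e = prime-divisor e {{nonZero-divisor e∣q^a}} e≢1
  in ⊥-elim (q∤e (subst (_∣ e) (prime∣prime^ a p-prime q-prime (∣-trans p∣e e∣q^a)) p∣e))
  where
  instance
    q^a≢0 : NonZero (q ^ a)
    q^a≢0 = m^n≢0 q a {{prime⇒nonZero q-prime}}

-- These are exactly the factors by which the length of an S-orbit
-- exceeds the length n of the S^r-orbits it splits into.
Admissible : ℕ → ℕ → ℕ → Set
Admissible r n d = ∃ λ e → r ≡ e * d × Coprime n e

admissible-∣ : ∀ {r n d} → Admissible r n d → d ∣ r
admissible-∣ (e , r≡e*d , _) = divides e r≡e*d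

admissible-nonZero : ∀ {r n d} .{{_ : NonZero r}} → Admissible r n d → NonZero d
admissible-nonZero admissible = nonZero-divisor (admissible-∣ admissible)

admissible-gcd : ∀ {r n d} → Admissible r n d → gcd (n * d) r ≡ d
admissible-gcd {r} {n} {d} (e , r≡e*d , n⊥e) = begin
  gcd (n * d) r     ≡⟨ cong₂ gcd (*-comm n d) (trans r≡e*d (*-comm e d)) ⟩
  gcd (d * n) (d * e) ≡⟨ sym (c*gcd[m,n]≡gcd[cm,cn] d n e) ⟩
  d * gcd n e       ≡⟨ cong (d *_) (coprime⇒gcd≡1 n⊥e) ⟩
  d * 1             ≡⟨ *-identityʳ d ⟩
  d                 ∎

-- Conversely, if y has S-period m and lies on a closed S^r-orbit of length n, then
-- m = n·g for an admissible g, namely g = gcd(m, r).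
period-split : ∀ {X : Set} {S : X → X} {r n m y} .{{_ : NonZero r}} .{{_ : NonZero n}} .{{_ : NonZero m}} →
  ClosedOrbitOfLength (iter S r) n y → ClosedOrbitOfLength S m y →
  ∃ λ g → Admissible r n g × m ≡ n * g
period-split {S = S} {r} {n} {m} {y} closed-r closed-1 =
  g , (r / g , sym r/g*g≡r , subst (λ k → Coprime k (r / g)) m/g≡n m/g⊥r/g) ,
  trans (sym m/g*g≡m) (cong (_* g) m/g≡n)
  where
  g : ℕ
  g = gcd m r
  instance
    g≢0 : NonZero g
    g≢0 = nonZero-divisor (gcd[m,n]∣m m r)
  m/g*g≡m : m / g * g ≡ m
  m/g*g≡m = m/n*n≡m (gcd[m,n]∣m m r)
  r/g*g≡r : r / g * g ≡ r
  r/g*g≡r = m/n*n≡m (gcd[m,n]∣n m r)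
  m/g⊥r/g : Coprime (m / g) (r / g)
  m/g⊥r/g = coprime-/gcd m r
  -- S^(r·m/g) = S^((r/g)·m) fixes y, so n divides m/g ...
  n∣m/g : n ∣ m / g
  n∣m/g = closed-∣ (iter S r) closed-r (m / g) (trans (iter-* S r (m / g) y)
    (periodic-∣ S (proj₁ closed-1) (divides (r / g) (begin
      r * (m / g)         ≡⟨ cong (_* (m / g)) (sym r/g*g≡r) ⟩
      r / g * g * (m / g) ≡⟨ regroup (r / g) g (m / g) ⟩
      r / g * (m / g * g) ≡⟨ cong (r / g *_) m/g*g≡m ⟩
      r / g * m           ∎))))
    where
    regroup : ∀ a b c → a * b * c ≡ a * (c * b)
    regroup = solve-∀
  -- ... and S^(r·n) fixes y, so m ∣ r·n, i.e. m/g ∣ (r/g)·n, hence m/g ∣ n by coprimality.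
  m/g∣n : m / g ∣ n
  m/g∣n = coprime-divisor m/g⊥r/g (*-cancelʳ-∣ g (subst₂ _∣_ (sym m/g*g≡m) regrouped
    (closed-∣ S closed-1 (r * n) (trans (sym (iter-* S r n y)) (proj₁ closed-r)))))
    where
    regrouped : r * n ≡ r / g * n * g
    regrouped = trans (cong (_* n) (sym r/g*g≡r)) (regroup (r / g) g n)
      where
      regroup : ∀ a b c → a * b * c ≡ a * c * b
      regroup = solve-∀
  m/g≡n : m / g ≡ n
  m/g≡n = ∣-antisym m/g∣n n∣m/g

module _ {X : Set} (S : X → X) {r : ℕ} where

  bézout-step : ∀ {m d z} .{{_ : NonZero m}} → iter S m z ≡ z →
    Bézout.Identity d m r → InOrbit (iter S r) z (iter S d z)
  bézout-step {m} {d} {z} fix (Bézout.-+ x y d+xm≡yr) = y , (begin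
    iter (iter S r) y z  ≡⟨ iter-* S r y z ⟩
    iter S (r * y) z     ≡⟨ cong (λ k → iter S k z) (trans (*-comm r y) (sym d+xm≡yr)) ⟩
    iter S (d + x * m) z ≡⟨ iter-+ S d (x * m) z ⟩
    iter S d (iter S (x * m) z) ≡⟨ cong (iter S d) (periodic-* S fix x) ⟩
    iter S d z           ∎)
  bézout-step {zero} _ (Bézout.+- _ _ _) = ⊥-elim (≢-nonZero⁻¹ 0 refl)
  bézout-step {suc k} {d} {z} fix (Bézout.+- x y d+yr≡xm) = y * k , (begin
    iter (iter S r) (y * k) z             ≡⟨ iter-* S r (y * k) z ⟩
    iter S (r * (y * k)) z                ≡⟨ cong (iter S (r * (y * k))) (sym (periodic-* S fix x)) ⟩
    iter S (r * (y * k)) (iter S (x * m) z) ≡⟨ sym (iter-+ S (r * (y * k)) (x * m) z) ⟩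
    iter S (r * (y * k) + x * m) z        ≡⟨ cong (λ j → iter S j z) exponents ⟩
    iter S (d + r * y * m) z              ≡⟨ iter-+ S d (r * y * m) z ⟩
    iter S d (iter S (r * y * m) z)       ≡⟨ cong (iter S d) (periodic-* S fix (r * y)) ⟩
    iter S d z                            ∎)
    where
    m : ℕ
    m = suc k
    regroup : ∀ r y k d → r * (y * k) + (d + y * r) ≡ d + r * y * suc k
    regroup = solve-∀
    exponents : r * (y * k) + x * m ≡ d + r * y * m
    exponents = trans (cong (r * (y * k) +_) (sym d+yr≡xm)) (regroup r y k d)

  bézout-steps : ∀ {m d} .{{_ : NonZero m}} → (∀ {z} → iter S m z ≡ z → InOrbit (iter S r) z (iter S d z)) →
    ∀ {x} → iter S m x ≡ x → ∀ w → InOrbit (iter S r) x (iter S (w * d) x)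
  bézout-steps step fix zero    = 0 , refl
  bézout-steps {m} {d} step {x} fix (suc w) =
    inOrbit-trans (iter S r) (bézout-steps step fix w)
      (subst (InOrbit (iter S r) (iter S (w * d) x)) (sym (iter-+ S d (w * d) x))
        (step (periodic-shift S {m} fix (w * d))))

OrbitCountOn : {X : Set} → (X → X) → ℕ → (X → Set) → ℕ → Set
OrbitCountOn {X} R n C c =
  Σ (Fin c → X) λ xs →
    (∀ a → ClosedOrbitOfLength R n (xs a)) ×
    (∀ a → C (xs a)) ×
    (∀ a b → InOrbit R (xs a) (xs b) → a ≡ b) ×
    (∀ y → ClosedOrbitOfLength R n y → C y → ∃ λ a → InOrbit R (xs a) y)

module _ {X : Set} (R : X → X) (n : ℕ) where

  Invariant : (X → Set) → Set
  Invariant C = ∀ {y z} → C y → InOrbit R y z → C z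

  orbitCountOn-∅ : ∀ {C} → (∀ {y} → ¬ C y) → OrbitCountOn R n C 0
  orbitCountOn-∅ empty = (λ ()) , (λ ()) , (λ ()) , (λ ()) , λ _ _ y∈C → ⊥-elim (empty y∈C)

  orbitCountOn-⊎ : ∀ {C₁ C₂ c₁ c₂} → Invariant C₁ → Invariant C₂ → (∀ {y} → C₁ y → C₂ y → ⊥) →
    OrbitCountOn R n C₁ c₁ → OrbitCountOn R n C₂ c₂ → OrbitCountOn R n (λ y → C₁ y ⊎ C₂ y) (c₁ + c₂)
  orbitCountOn-⊎ {C₁} {C₂} {c₁} {c₂} inv₁ inv₂ disjoint
    (xs₁ , closed₁ , in₁ , separated₁ , complete₁) (xs₂ , closed₂ , in₂ , separated₂ , complete₂) =
    xs , closed , inC , separated , complete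
    where
    xs : Fin (c₁ + c₂) → X
    xs i = [ xs₁ , xs₂ ]′ (splitAt c₁ i)
    closed : ∀ i → ClosedOrbitOfLength R n (xs i)
    closed i with splitAt c₁ i
    ... | inj₁ a = closed₁ a
    ... | inj₂ b = closed₂ b
    inC : ∀ i → C₁ (xs i) ⊎ C₂ (xs i)
    inC i with splitAt c₁ i
    ... | inj₁ a = inj₁ (in₁ a)
    ... | inj₂ b = inj₂ (in₂ b)
    separated : ∀ i i' → InOrbit R (xs i) (xs i') → i ≡ i'
    separated i i' o with splitAt c₁ i in eq | splitAt c₁ i' in eq'
    ... | inj₁ a | inj₁ a' = trans (sym (Finₚ.splitAt⁻¹-↑ˡ eq)) (trans (cong (_↑ˡ c₂) (separated₁ a a' o)) (Finₚ.splitAt⁻¹-↑ˡ eq'))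
    ... | inj₂ b | inj₂ b' = trans (sym (Finₚ.splitAt⁻¹-↑ʳ eq)) (trans (cong (c₁ ↑ʳ_) (separated₂ b b' o)) (Finₚ.splitAt⁻¹-↑ʳ eq'))
    ... | inj₁ a | inj₂ b' = ⊥-elim (disjoint (inv₁ (in₁ a) o) (in₂ b'))
    ... | inj₂ b | inj₁ a' = ⊥-elim (disjoint (in₁ a') (inv₂ (in₂ b) o))
    complete : ∀ y → ClosedOrbitOfLength R n y → C₁ y ⊎ C₂ y → ∃ λ i → InOrbit R (xs i) y
    complete y cy (inj₁ y∈C₁) = let a , o = complete₁ y cy y∈C₁ in
      a ↑ˡ c₂ , subst (λ s → InOrbit R ([ xs₁ , xs₂ ]′ s) y) (sym (Finₚ.splitAt-↑ˡ c₁ a c₂)) o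
    complete y cy (inj₂ y∈C₂) = let b , o = complete₂ y cy y∈C₂ in
      c₁ ↑ʳ b , subst (λ s → InOrbit R ([ xs₁ , xs₂ ]′ s) y) (sym (Finₚ.splitAt-↑ʳ c₁ c₂ b)) o

  orbitCountOn-⇔ : ∀ {C C' c} → (∀ {y} → C y → C' y) → (∀ {y} → C' y → C y) →
    OrbitCountOn R n C c → OrbitCountOn R n C' c
  orbitCountOn-⇔ to from (xs , closed , inC , separated , complete) =
    xs , closed , (λ a → to (inC a)) , separated , λ y cy y∈C' → complete y cy (from y∈C')

  orbitCountOn-all : ∀ {C c} → (∀ {y} → ClosedOrbitOfLength R n y → C y) →
    OrbitCountOn R n C c → OrbitCount R n c
  orbitCountOn-all everything (xs , closed , _ , separated , complete) =
    xs , closed , separated , λ y cy → complete y cy (everything cy)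

-- A single admissible factor d: every closed S-orbit of length n·d splits into
-- exactly d closed S^r-orbits of length n, namely those of x, S x, ..., S^(d-1) x.
module Block {X : Set} (S : X → X) {r n d : ℕ} .{{_ : NonZero n}} .{{_ : NonZero d}}
  (admissible : Admissible r n d) where

  m : ℕ
  m = n * d

  instance
    m≢0 : NonZero m
    m≢0 = m*n≢0 n d

  closed-iterate : ∀ {x} → ClosedOrbitOfLength S m x → ClosedOrbitOfLength (iter S r) n x
  closed-iterate {x} closed = closed-intro (iter S r) fix n-divides
    where
    e : ℕ
    e = proj₁ admissible
    r≡e*d : r ≡ e * d
    r≡e*d = proj₁ (proj₂ admissible)
    fix : iter (iter S r) n x ≡ x
    fix = trans (iter-* S r n x) (periodic-∣ S (proj₁ closed) (divides e (begin
      r * n       ≡⟨ cong (_* n) r≡e*d ⟩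
      e * d * n   ≡⟨ regroup e d n ⟩
      e * (n * d) ∎)))
      where
      regroup : ∀ e d n → e * d * n ≡ e * (n * d)
      regroup = solve-∀
    -- S^(r·t) x = x gives n·d ∣ e·d·t, so n ∣ e·t and n ∣ t as n is coprime to e.
    n-divides : ∀ t → iter (iter S r) t x ≡ x → n ∣ t
    n-divides t ret = coprime-divisor (proj₂ (proj₂ admissible)) (*-cancelʳ-∣ d
      (subst (m ∣_) (trans (cong (_* t) r≡e*d) (regroup e d t))
        (closed-∣ S closed (r * t) (trans (sym (iter-* S r t x)) ret))))
      where
      regroup : ∀ e d t → e * d * t ≡ e * t * d
      regroup = solve-∀

  -- Along an S-orbit of period n·d, S^r reaches all multiples of d = gcd(n·d, r) ...
  d-steps : ∀ {x} → iter S m x ≡ x → ∀ w → InOrbit (iter S r) x (iter S (w * d) x)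
  d-steps = bézout-steps S {r} {m} (λ fix → bézout-step S {r} {m} fix d-identity)
    where
    d-identity : Bézout.Identity d m r
    d-identity = subst (λ g → Bézout.Identity g m r) (admissible-gcd admissible) (Bézout.identity (gcd-GCD m r))

  from-offset : ∀ {x} → iter S m x ≡ x → ∀ u → InOrbit (iter S r) (iter S (u % d) x) (iter S u x)
  from-offset {x} fix u = subst (InOrbit (iter S r) (iter S (u % d) x)) recombine
    (d-steps (periodic-shift S {m} fix (u % d)) (u / d))
    where
    recombine : iter S (u / d * d) (iter S (u % d) x) ≡ iter S u x
    recombine = begin
      iter S (u / d * d) (iter S (u % d) x) ≡⟨ iter-comm S (u / d * d) (u % d) x ⟩
      iter S (u % d) (iter S (u / d * d) x) ≡⟨ sym (iter-+ S (u % d) (u / d * d) x) ⟩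
      iter S (u % d + u / d * d) x          ≡⟨ cong (λ k → iter S k x) (sym (m≡m%n+[m/n]*n u d)) ⟩
      iter S u x                            ∎

  -- Distinct offsets below d lie on distinct S^r-orbits: since d divides both r
  -- and the period n·d, S^(r·t) preserves the offset modulo d.
  offset-unique : ∀ {x} → ClosedOrbitOfLength S m x → ∀ t {j j'} → j < d → j' < d →
    iter S (r * t + j) x ≡ iter S j' x → j ≡ j'
  offset-unique closed t {j} {j'} j<d j'<d eq = begin
    j                   ≡⟨ sym (m<n⇒m%n≡m j<d) ⟩
    j % d               ≡⟨ sym (%-remove-+ˡ j (∣m⇒∣m*n t (admissible-∣ admissible))) ⟩
    (r * t + j) % d     ≡⟨ sym (m∣n⇒o%n%m≡o%m d m (r * t + j) d∣m) ⟩
    (r * t + j) % m % d ≡⟨ cong (_% d) (closed-% S closed (r * t + j) j' eq) ⟩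
    j' % m % d          ≡⟨ m∣n⇒o%n%m≡o%m d m j' d∣m ⟩
    j' % d              ≡⟨ m<n⇒m%n≡m j'<d ⟩
    j'                  ∎
    where
    d∣m : d ∣ m
    d∣m = n∣m*n n

  -- The count: c closed S-orbits of length n·d give d·c closed S^r-orbits of
  -- length n, represented by S^j x_a for offsets j < d and representatives x_a.
  splits : ∀ {c} → OrbitCount S m c → OrbitCountOn (iter S r) n (ClosedOrbitOfLength S m) (d * c)
  splits {c} (xs , closed , separated , complete) =
    ys , (λ i → closed-iterate (ys-closed i)) , ys-closed , ys-separated , ys-complete
    where
    offset : Fin (d * c) → Fin d
    offset i = proj₁ (remQuot {d} c i)
    base : Fin (d * c) → Fin c
    base i = proj₂ (remQuot {d} c i)
    ys : Fin (d * c) → X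
    ys i = iter S (toℕ (offset i)) (xs (base i))
    ys-closed : ∀ i → ClosedOrbitOfLength S m (ys i)
    ys-closed i = closed-inOrbit S (closed (base i)) (toℕ (offset i) , refl)
    ys-separated : ∀ i i' → InOrbit (iter S r) (ys i) (ys i') → i ≡ i'
    ys-separated i i' (t , reach) = begin
      i                                  ≡⟨ sym (Finₚ.combine-remQuot {d} c i) ⟩
      combine (offset i) (base i)        ≡⟨ cong₂ combine same-offset same-base ⟩
      combine (offset i') (base i')      ≡⟨ Finₚ.combine-remQuot {d} c i' ⟩
      i'                                 ∎
      where
      j j' : ℕ
      j = toℕ (offset i)
      j' = toℕ (offset i')
      reach-S : iter S (r * t + j) (xs (base i)) ≡ ys i'
      reach-S = trans (iter-+ S (r * t) j _) (trans (sym (iter-* S r t _)) reach)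
      same-base : base i ≡ base i'
      same-base = separated (base i) (base i')
        (inOrbit-trans S (r * t + j , reach-S) (m * j' ∸ j' , periodic-return S {m} (proj₁ (closed (base i'))) j'))
      same-offset : offset i ≡ offset i'
      same-offset = Finₚ.toℕ-injective (offset-unique (closed (base i)) t (Finₚ.toℕ<n (offset i)) (Finₚ.toℕ<n (offset i'))
        (trans reach-S (cong (λ a → iter S j' (xs a)) (sym same-base))))
    ys-complete : ∀ y → ClosedOrbitOfLength (iter S r) n y → ClosedOrbitOfLength S m y →
      ∃ λ i → InOrbit (iter S r) (ys i) y
    ys-complete y _ y-closed with complete y y-closed
    ... | a , u , refl = combine j a , subst (λ z → InOrbit (iter S r) z (iter S u (xs a))) (sym ys-at)
      (from-offset (proj₁ (closed a)) u)
      where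
      j : Fin d
      j = fromℕ< (m%n<n u d)
      ys-at : ys (combine j a) ≡ iter S (u % d) (xs a)
      ys-at = trans (cong (λ ja → iter S (toℕ (proj₁ ja)) (xs (proj₂ ja))) (Finₚ.remQuot-combine {d} {c} j a))
        (cong (λ k → iter S k (xs a)) (Finₚ.toℕ-fromℕ< (m%n<n u d)))

no-closed-orbit : ∀ {X : Set} {R : X → X} {m y} → OrbitCount R m 0 → ¬ ClosedOrbitOfLength R m y
no-closed-orbit (_ , _ , _ , complete) closed with complete _ closed
... | () , _

-- The orbit count of an iterate S^r in terms of S: a closed S^r-orbit of length n
-- lies in a closed S-orbit of length n·d for an admissible d, and each such S-orbit
-- splits into d of them, so that O_{S^r}(n) = Σ_d d·O_S(n·d).
module _ {X : Set} (S : X → X) (finite : FinitelyManyFixedPoints S) (r n : ℕ)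
  .{{_ : NonZero r}} .{{_ : NonZero n}} where

  ClosedOnSome : List ℕ → X → Set
  ClosedOnSome ds y = Any (λ d → ClosedOrbitOfLength S (n * d) y) ds

  closed-invariant : ∀ k → Invariant (iter S r) n (ClosedOrbitOfLength S k)
  closed-invariant k closed (t , refl) = closed-inOrbit S closed (r * t , sym (iter-* S r t _))

  closedOnSome-invariant : ∀ {ds} → Invariant (iter S r) n (ClosedOnSome ds)
  closedOnSome-invariant on-ds o = Any.map (λ closed → closed-invariant _ closed o) on-ds

  blocks : ∀ {ds} → Unique ds → (c : ℕ → ℕ) →
    All (λ d → Admissible r n d × OrbitCount S (n * d) (c d)) ds →
    OrbitCountOn (iter S r) n (ClosedOnSome ds) (sum (map (λ d → d * c d) ds))
  blocks {[]}     []                 c []                    = orbitCountOn-∅ (iter S r) n (λ ())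
  blocks {d ∷ ds} (d∉ds ∷ unique) c ((admissible , count) ∷ rest) =
    orbitCountOn-⇔ (iter S r) n fromSum toSum
      (orbitCountOn-⊎ (iter S r) n (closed-invariant (n * d)) closedOnSome-invariant
        disjoint (Block.splits S admissible count) (blocks unique c rest))
    where
    instance
      d≢0 : NonZero d
      d≢0 = admissible-nonZero admissible
    -- A point has only one orbit length, and d does not occur in ds.
    disjoint : ∀ {y} → ClosedOrbitOfLength S (n * d) y → ClosedOnSome ds y → ⊥
    disjoint closed-d on-ds with find on-ds
    ... | d' , d'∈ds , closed-d' = All.lookup d∉ds d'∈ds (*-cancelˡ-≡ d d' n
      (closed-unique S {{m*n≢0 n d}} {{m*n≢0 n d' {{it}} {{admissible-nonZero (proj₁ (All.lookup rest d'∈ds))}}}} closed-d closed-d'))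

  -- Every closed S^r-orbit of length n lies in a closed S-orbit of length n·g for an
  -- admissible g: take the minimal S-period of the point and split it.
  closed-of-iterate : ∀ {y} → ClosedOrbitOfLength (iter S r) n y →
    ∃ λ g → Admissible r n g × ClosedOrbitOfLength S (n * g) y
  closed-of-iterate {y} closed =
    let m , m≢0 , closed-S = closed-of-periodic finite {{m*n≢0 r n}} (trans (sym (iter-* S r n y)) (proj₁ closed))
        g , admissible , m≡n*g = period-split {{it}} {{it}} {{m≢0}} closed closed-S
    in  g , admissible , subst (λ k → ClosedOrbitOfLength S k y) m≡n*g closed-S

  iterate-orbitCount : ∀ {ds} → Unique ds → (c : ℕ → ℕ) →
    All (λ d → Admissible r n d × OrbitCount S (n * d) (c d)) ds →
    (∀ {g y} → Admissible r n g → ClosedOrbitOfLength S (n * g) y → g ∈ ds) →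
    OrbitCount (iter S r) n (sum (map (λ d → d * c d) ds))
  iterate-orbitCount unique c counts covering =
    orbitCountOn-all (iter S r) n everything (blocks unique c counts)
    where
    everything : ∀ {y} → ClosedOrbitOfLength (iter S r) n y → ClosedOnSome _ y
    everything closed = let g , admissible , closed-g = closed-of-iterate closed in
      lose (covering admissible closed-g) closed-g

  iterate-no-orbits : (∀ {g} → Admissible r n g → OrbitCount S (n * g) 0) → OrbitCount (iter S r) n 0
  iterate-no-orbits none = iterate-orbitCount [] (λ _ → 0) []
    λ admissible closed → ⊥-elim (no-closed-orbit (none admissible) closed)

divisors : ℕ → List ℕ
divisors m = filter (λ d → d ∣? m) (applyUpTo suc m)

divisors-unique : ∀ m → Unique (divisors m)
divisors-unique m = Uniqueₚ.filter⁺ (λ d → d ∣? m)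
  (Uniqueₚ.applyUpTo⁺₁ suc m (λ i<j _ 1+i≡1+j → <⇒≢ i<j (suc-injective 1+i≡1+j)))

∈-divisors⁻ : ∀ {d m} → d ∈ divisors m → d ∣ m
∈-divisors⁻ {m = m} d∈ = proj₂ (∈ₚ.∈-filter⁻ (λ d → d ∣? m) {xs = applyUpTo suc m} d∈)

∈-divisors⁺ : ∀ {d m} .{{_ : NonZero m}} → d ∣ m → d ∈ divisors m
∈-divisors⁺ {zero}  {m} 0∣m = ⊥-elim (≢-nonZero⁻¹ m (0∣⇒≡0 0∣m))
∈-divisors⁺ {suc d} {m} d∣m = ∈ₚ.∈-filter⁺ (λ d → d ∣? m) (∈ₚ.∈-applyUpTo⁺ suc (∣⇒≤ d∣m)) d∣m

sum-map-*ʳ : ∀ c ds → sum (map (λ d → d * c) ds) ≡ sum ds * c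
sum-map-*ʳ c []       = refl
sum-map-*ʳ c (d ∷ ds) = trans (cong (d * c +_) (sum-map-*ʳ c ds)) (sym (*-distribʳ-+ c d (sum ds)))

-- Iterating to a prime power q^a: if O_S(n·d) = c for every d ∣ q^a, then
-- O_{S^(q^a)}(n) = q^a·c when q ∣ n (only d = q^a is admissible) and
-- σ(q^a)·c when q ∤ n (every divisor is admissible).
module _ {X : Set} (S : X → X) (finite : FinitelyManyFixedPoints S)
  {q : ℕ} (q-prime : Prime q) (a n : ℕ) .{{_ : NonZero n}} where

  instance
    q^a≢0 : NonZero (q ^ a)
    q^a≢0 = m^n≢0 q a {{prime⇒nonZero q-prime}}

  -- If q ∣ n, then n is coprime only to the cofactor 1.
  admissible-q∣n : q ∣ n → ∀ {g} → Admissible (q ^ a) n g → g ≡ q ^ a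
  admissible-q∣n q∣n {g} (e , q^a≡e*g , n⊥e) = begin
    g     ≡⟨ sym (*-identityˡ g) ⟩
    1 * g ≡⟨ cong (_* g) (sym e≡1) ⟩
    e * g ≡⟨ sym q^a≡e*g ⟩
    q ^ a ∎
    where
    e≡1 : e ≡ 1
    e≡1 = prime^-divisor a q-prime (divides g (trans q^a≡e*g (*-comm e g)))
      (λ q∣e → ¬prime[1] (subst Prime (n⊥e (q∣n , q∣e)) q-prime))

  admissible-q∤n : ¬ q ∣ n → ∀ {d} → d ∣ q ^ a → Admissible (q ^ a) n d
  admissible-q∤n q∤n d∣q^a = quotient d∣q^a , m∣n⇒n≡quotient*m d∣q^a ,
    coprime-by-primes λ p p-prime p∣n p∣e →
      q∤n (subst (_∣ n) (prime∣prime^ a p-prime q-prime (∣-trans p∣e (quotient-∣ d∣q^a))) p∣n)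

  prime-power-iterate : ∀ c → (∀ {d} → d ∣ q ^ a → OrbitCount S (n * d) c) →
    OrbitCount (iter S (q ^ a)) n ((if does (q ∣? n) then q ^ a else σ (q ^ a)) * c)
  prime-power-iterate c counts with q ∣? n
  ... | yes q∣n = subst (OrbitCount (iter S (q ^ a)) n) (+-identityʳ (q ^ a * c))
    (iterate-orbitCount S finite (q ^ a) n ([] ∷ []) (λ _ → c) ((admissible-top , counts ∣-refl) ∷ [])
      λ admissible _ → here (admissible-q∣n q∣n admissible))
    where
    admissible-top : Admissible (q ^ a) n (q ^ a)
    admissible-top = 1 , sym (*-identityˡ (q ^ a)) , Coprimality.sym (1-coprimeTo n)
  ... | no q∤n = subst (OrbitCount (iter S (q ^ a)) n) (sum-map-*ʳ c (divisors (q ^ a)))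
    (iterate-orbitCount S finite (q ^ a) n (divisors-unique (q ^ a)) (λ _ → c)
      (All.tabulate λ d∈ → admissible-q∤n q∤n (∈-divisors⁻ d∈) , counts (∈-divisors⁻ d∈))
      λ admissible _ → ∈-divisors⁺ (admissible-∣ admissible))

does-⇔ : ∀ {A B : Set} → (A → B) → (B → A) → (a? : Dec A) (b? : Dec B) → does a? ≡ does b?
does-⇔ to from (yes a) b? = sym (dec-true b? (to a))
does-⇔ to from (no ¬a) b? = sym (dec-false b? (¬a ∘ from))

-- The factor ∏_{p∣n} p^a · ∏_{p∤n} σ(p^a) only depends on which listed primes divide
-- n, so it is unchanged by a cofactor d that no listed prime divides.
orbitFactor-* : ∀ qs {n d} → All (λ q → Prime (proj₁ q) × ¬ proj₁ q ∣ d) qs →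
  orbitFactor qs (n * d) ≡ orbitFactor qs n
orbitFactor-* []             []                      = refl
orbitFactor-* ((p , b) ∷ qs) {n} {d} ((p-prime , p∤d) ∷ rest) =
  cong₂ _*_ (cong (λ t → if t then p ^ b else σ (p ^ b)) (does-⇔ to (∣m⇒∣m*n d) (p ∣? n * d) (p ∣? n)))
            (orbitFactor-* qs rest)
  where
  to : p ∣ n * d → p ∣ n
  to p∣n*d with euclidsLemma n d p-prime p∣n*d
  ... | inj₁ p∣n = p∣n
  ... | inj₂ p∣d = ⊥-elim (p∤d p∣d)

PFree PDiv : (ℕ → Set) → ℕ → Set
PFree P n = ∀ p → P p → ¬ (p ∣ n)
PDiv  P n = ∃ λ p → P p × p ∣ n

π : List (ℕ × ℕ) → ℕ
π qs = product (map (λ q → proj₁ q ^ proj₂ q) qs)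

π-nonZero : ∀ {A : ℕ → Set} qs → All (λ q → Prime (proj₁ q) × A (proj₁ q)) qs → NonZero (π qs)
π-nonZero []             []                  = _
π-nonZero ((q , a) ∷ qs) ((q-prime , _) ∷ rest) =
  m*n≢0 (q ^ a) (π qs) {{m^n≢0 q a {{prime⇒nonZero q-prime}}}} {{π-nonZero qs rest}}

module _ (P : ℕ → Set) (P-prime : ∀ p → P p → Prime p) {X : Set} where

  Formula : (X → X) → List (ℕ × ℕ) → Set
  Formula S qs = ∀ n → .{{_ : NonZero n}} →
    (PFree P n → OrbitCount S n (orbitFactor qs n)) × (PDiv P n → OrbitCount S n 0)

  Formula-≗ : ∀ {f g : X → X} {qs} → (∀ x → f x ≡ g x) → Formula f qs → Formula g qs
  Formula-≗ f≗g formula n = let free , div = formula n in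
    (λ n-free → orbitCount-≗ f≗g (free n-free)) , (λ n-div → orbitCount-≗ f≗g (div n-div))

  PFree-* : ∀ {n d q} a → Prime q → ¬ P q → d ∣ q ^ a → PFree P n → PFree P (n * d)
  PFree-* {n} {d} a q-prime ¬Pq d∣q^a n-free p Pp p∣n*d with euclidsLemma n d (P-prime p Pp) p∣n*d
  ... | inj₁ p∣n = n-free p Pp p∣n
  ... | inj₂ p∣d = ¬Pq (subst P (prime∣prime^ a (P-prime p Pp) q-prime (∣-trans p∣d d∣q^a)) Pp)

  PDiv-* : ∀ {n} d → PDiv P n → PDiv P (n * d)
  PDiv-* d (p , Pp , p∣n) = p , Pp , ∣m⇒∣m*n d p∣n

  prime-power-step : ∀ {S : X → X} {q a qs} → FinitelyManyFixedPoints S → Prime q → ¬ P q →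
    All (λ q' → Prime (proj₁ q') × q ≢ proj₁ q') qs →
    Formula S qs → Formula (iter S (q ^ a)) ((q , a) ∷ qs)
  prime-power-step {S} {q} {a} {qs} finite q-prime ¬Pq others formula n = free , div
    where
    positive : ∀ {d} → d ∣ q ^ a → NonZero (n * d)
    positive d∣q^a = m*n≢0 n _ {{it}} {{nonZero-divisor {{m^n≢0 q a {{prime⇒nonZero q-prime}}}} d∣q^a}}
    coprime-to-others : ∀ {d} → d ∣ q ^ a → All (λ q' → Prime (proj₁ q') × ¬ proj₁ q' ∣ d) qs
    coprime-to-others d∣q^a = All.map (λ { (p-prime , q≢p) →
      p-prime , λ p∣d → q≢p (sym (prime∣prime^ a p-prime q-prime (∣-trans p∣d d∣q^a))) }) others
    free : PFree P n → OrbitCount (iter S (q ^ a)) n (orbitFactor ((q , a) ∷ qs) n)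
    free n-free = prime-power-iterate S finite q-prime a n (orbitFactor qs n) λ {d} d∣q^a →
      subst (OrbitCount S (n * d)) (orbitFactor-* qs (coprime-to-others d∣q^a))
        (proj₁ (formula (n * d) {{positive d∣q^a}}) (PFree-* a q-prime ¬Pq d∣q^a n-free))
    div : PDiv P n → OrbitCount (iter S (q ^ a)) n 0
    div n-div = iterate-no-orbits S finite (q ^ a) n {{m^n≢0 q a {{prime⇒nonZero q-prime}}}} λ {g} admissible →
      proj₂ (formula (n * g) {{positive (admissible-∣ admissible)}}) (PDiv-* g n-div)

  module _ (T : X → X) (T-finite : FinitelyManyFixedPoints T)
    (T-free : ∀ n → 1 ≤ n → PFree P n → OrbitCount T n 1)
    (T-div : ∀ n → 1 ≤ n → PDiv P n → OrbitCount T n 0)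
    (kP : ℕ) (kP-P : ∀ p → Prime p → p ∣ kP → P p) .{{_ : NonZero kP}} where

    -- The base case k = kP: every prime factor of kP lies in P, so for P-free n only
    -- the factor 1 can carry orbits, and O_{T^kP}(n) = O_T(n).
    P-part : Formula (iter T kP) []
    P-part n = free , div
      where
      positive : ∀ {g} → Admissible kP n g → 1 ≤ n * g
      positive admissible = >-nonZero⁻¹ _ {{m*n≢0 n _ {{it}} {{admissible-nonZero admissible}}}}
      free : PFree P n → OrbitCount (iter T kP) n 1
      free n-free = iterate-orbitCount T T-finite kP n ([] ∷ []) (λ _ → 1)
        ((admissible-1 , T-free (n * 1) (positive admissible-1) (subst (PFree P) (sym (*-identityʳ n)) n-free)) ∷ [])
        only-1
        where
        admissible-1 : Admissible kP n 1
        admissible-1 = kP , sym (*-identityʳ kP) ,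
          coprime-by-primes λ p p-prime p∣n p∣kP → n-free p (kP-P p p-prime p∣kP) p∣n
        -- A factor g ≠ 1 of kP contains a prime of P, so T has no orbits of length n·g.
        only-1 : ∀ {g y} → Admissible kP n g → ClosedOrbitOfLength T (n * g) y → g ∈ 1 ∷ []
        only-1 {g} admissible closed with g ≟ 1
        ... | yes g≡1 = here g≡1
        ... | no  g≢1 =
          let p , p-prime , p∣g = prime-divisor g {{admissible-nonZero admissible}} g≢1
          in ⊥-elim (no-closed-orbit (T-div (n * g) (positive admissible)
               (p , kP-P p p-prime (∣-trans p∣g (admissible-∣ admissible)) , ∣n⇒∣m*n n p∣g)) closed)
      div : PDiv P n → OrbitCount (iter T kP) n 0
      div n-div = iterate-no-orbits T T-finite kP n λ {g} admissible →
        T-div (n * g) (positive admissible) (PDiv-* g n-div)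

    formula : ∀ qs → All (λ q → Prime (proj₁ q) × ¬ P (proj₁ q)) qs → Unique (map proj₁ qs) →
      Formula (iter T (kP * π qs)) qs
    formula [] _ _ = subst (λ k → Formula (iter T k) []) (sym (*-identityʳ kP)) P-part
    formula ((q , a) ∷ qs) ((q-prime , ¬Pq) ∷ qs-ok) (q∉qs ∷ qs-unique) =
      Formula-≗ {qs = (q , a) ∷ qs} regroup
        (prime-power-step {q = q} {a} {qs} (iterate-finite T-finite k) q-prime ¬Pq others (formula qs qs-ok qs-unique))
      where
      k : ℕ
      k = kP * π qs
      instance
        k≢0 : NonZero k
        k≢0 = m*n≢0 kP (π qs) {{it}} {{π-nonZero qs qs-ok}}
      others : All (λ q' → Prime (proj₁ q') × q ≢ proj₁ q') qs
      others = All.zipWith (λ { ((p-prime , _) , q≢p) → p-prime , q≢p }) (qs-ok , Allₚ.map⁻ q∉qs)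
      regroup : ∀ x → iter (iter T k) (q ^ a) x ≡ iter T (kP * (q ^ a * π qs)) x
      regroup x = trans (iter-* T k (q ^ a) x) (cong (λ j → iter T j x) (exponent kP (π qs) (q ^ a)))
        where
        exponent : ∀ u v w → u * v * w ≡ u * (w * v)
        exponent = solve-∀

lemma3p2 :
    (P : ℕ → Set) → (∀ p → P p → Prime p) →
    {X : Set} (T : X → X) → FinitelyManyFixedPoints T →
    (∀ n → 1 ≤ n → (∀ p → P p → ¬ (p ∣ n)) → OrbitCount T n 1) →
    (∀ n → 1 ≤ n → (∃ λ p → P p × p ∣ n) → OrbitCount T n 0) →
    (k : ℕ) → 1 ≤ k →
    (kP : ℕ) → (∀ p → Prime p → p ∣ kP → P p) →
    (qs : List (ℕ × ℕ)) → All (λ q → Prime (proj₁ q) × ¬ P (proj₁ q)) qs →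
    Unique (map proj₁ qs) →
    k ≡ kP * product (map (λ q → proj₁ q ^ proj₂ q) qs) →
    ∀ n → 1 ≤ n →
      ((∀ p → P p → ¬ (p ∣ n)) → OrbitCount (iter T k) n (orbitFactor qs n)) ×
      ((∃ λ p → P p × p ∣ n) → OrbitCount (iter T k) n 0)
lemma3p2 P P-prime T T-finite T-free T-div k k≥1 kP kP-P qs qs-ok qs-unique refl n n≥1 =
  formula P P-prime T T-finite T-free T-div kP kP-P {{kP≢0}} qs qs-ok qs-unique n {{>-nonZero n≥1}}
  where
  kP≢0 : NonZero kP
  kP≢0 = m*n≢0⇒m≢0 kP {{>-nonZero k≥1}}
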